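{- Let $G$ be a cubic graph and let $F$ be a $1$-factor (perfect matching) of $G$. Then there is a maximum $3$-edge-colorable subgraph $H$ of $G$ with $F\subseteq E(H)$.
   Context: All graphs are finite and undirected, without loops; multiple edges are allowed. A cubic graph is a $3$-regular graph. For a graph $G$ and a positive integer $k$, let $\nu_k(G)$ be the maximum of $|H_1|+\dots+|H_k|$ over all $k$-tuples $(H_1,\dots,H_k)$ of pairwise edge-disjoint matchings of $G$. A subgraph $H$ of $G$ is called maximum $k$-edge-colorable if it is $k$-edge-colorable (properly) and has exactly $\nu_k(G)$ edges. -}

module Defs where

open import Data.Nat using (ℕ; _≤_)
open import Data.Fin using (Fin; _≟_)
open import Data.Fin.Subset using (Subset; _∈_; _⊆_; ∣_∣)
open import Data.Product using (Σ; _×_; _,_; proj₁; proj₂)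
open import Data.Sum using (_⊎_)
open import Data.List using (List; length; filter; allFin; map)
open import Data.Nat.ListAction using (sum)
open import Relation.Nullary using (¬_; Dec)
open import Relation.Nullary.Decidable using (_⊎-dec_)
open import Relation.Binary.PropositionalEquality using (_≡_)

-- A finite multigraph (loops excluded, parallel edges allowed):
-- vertices Fin n, edges Fin m, each edge has two endpoints.
record Graph : Set where
  field
    n      : ℕ
    m      : ℕ
    ends   : Fin m → Fin n × Fin n
    noLoop : ∀ e → ¬ (proj₁ (ends e) ≡ proj₂ (ends e))

open Graph public

IncidentTo : (G : Graph) → Fin (n G) → Fin (m G) → Set
IncidentTo G v e = (v ≡ proj₁ (ends G e)) ⊎ (v ≡ proj₂ (ends G e))

incident? : (G : Graph) → (v : Fin (n G)) → (e : Fin (m G)) → Dec (IncidentTo G v e)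
incident? G v e = (v ≟ proj₁ (ends G e)) ⊎-dec (v ≟ proj₂ (ends G e))

-- degree = number of edges incident with v (no loops, so each edge counts once)
degree : (G : Graph) → Fin (n G) → ℕ
degree G v = length (filter (incident? G v) (allFin (m G)))

Cubic : Graph → Set
Cubic G = ∀ v → degree G v ≡ 3

Adjacent : (G : Graph) → Fin (m G) → Fin (m G) → Set
Adjacent G e f = Σ (Fin (n G)) λ v → IncidentTo G v e × IncidentTo G v f

IsMatching : (G : Graph) → Subset (m G) → Set
IsMatching G M = ∀ e f → e ∈ M → f ∈ M → ¬ (e ≡ f) → ¬ Adjacent G e f

IsPerfectMatching : (G : Graph) → Subset (m G) → Set
IsPerfectMatching G F = IsMatching G F × (∀ v → Σ (Fin (m G)) λ e → e ∈ F × IncidentTo G v e)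

-- the edge set S (a subgraph H with E(H) = S) is properly k-edge-colorable
KEdgeColorable : (G : Graph) → ℕ → Subset (m G) → Set
KEdgeColorable G k S = Σ (Fin (m G) → Fin k) λ c →
  ∀ e f → e ∈ S → f ∈ S → ¬ (e ≡ f) → Adjacent G e f → ¬ (c e ≡ c f)

DisjointMatchings : (G : Graph) → (k : ℕ) → (Fin k → Subset (m G)) → Set
DisjointMatchings G k Ms =
  (∀ i → IsMatching G (Ms i)) ×
  (∀ i j e → ¬ (i ≡ j) → e ∈ Ms i → ¬ (e ∈ Ms j))

totalSize : (G : Graph) → (k : ℕ) → (Fin k → Subset (m G)) → ℕ
totalSize G k Ms = sum (map (λ i → ∣ Ms i ∣) (allFin k))

-- |E(H)| = ν_k(G): no k-tuple of pairwise edge-disjoint matchings has more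
-- edges in total than S (and S, being k-edge-colorable, attains ν_k via its colour classes)
MaxKEdgeColorable : (G : Graph) → ℕ → Subset (m G) → Set
MaxKEdgeColorable G k S =
  KEdgeColorable G k S ×
  (∀ (Ms : Fin k → Subset (m G)) → DisjointMatchings G k Ms → totalSize G k Ms ≤ ∣ S ∣)

-- Among all proper partial k-colourings of the edges choose one that colours as many edges as possible
-- and, subject to that, as many edges of the matching F as possible. Suppose some e = uv in F stays
-- uncoloured. Since deg v ≤ k and e is uncoloured, some colour b is missing at v. If b is also missing
-- at u, colouring e with b gives a larger colouring. Otherwise the edge f at u coloured b is not in F
-- (F is a matching), and moving b from f to e keeps the number of coloured edges while colouring one
-- more edge of F. The colour classes of any k disjoint matchings form a proper partial colouring, so
-- the coloured edges form a maximum k-edge-colourable subgraph, and it contains F.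
module Submission where

open import Defs
open import Data.Product using (Σ; _×_)
open import Data.Fin.Subset using (Subset; _⊆_)

open import Data.Empty using (⊥; ⊥-elim)
open import Data.Fin using (Fin; zero; suc; _≟_)
open import Data.Fin.Properties using (any?; all?; ¬∀⟶∃¬; injective⇒≤)
open import Data.Fin.Subset using (inside; outside; _∈_; _∉_; _⊂_; _∪_; _∩_; _-_; ⋃; ∣_∣)
open import Data.Fin.Subset.Properties
  using (_∈?_; ∉⊥; x∈p∪q⁻; p─⊥≡p; p─q⊆p; ∣⊥∣≡0; x∈p∩q⁺; x∈p∩q⁻; p⊆q⇒∣p∣≤∣q∣; p⊂q⇒∣p∣<∣q∣)
open import Data.List as List using (List; []; _∷_; [_]; length; filter; allFin; cartesianProductWith)
open import Data.List.Properties using (map-∘)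
open import Data.List.Relation.Unary.All as All using (All; []; _∷_)
open import Data.List.Relation.Unary.All.Properties using (all-filter)
open import Data.List.Relation.Unary.AllPairs using (AllPairs; []; _∷_)
import Data.List.Relation.Unary.AllPairs.Properties as AllPairs
open import Data.List.Relation.Unary.Any as Any using (Any; index; satisfied)
open import Data.List.Relation.Unary.Any.Properties using (lookup-index)
import Data.List.Relation.Unary.Any.Properties as Any
open import Data.List.Relation.Unary.Enumerates.Setoid using (IsEnumeration)
open import Data.List.Extrema.Nat using (argmax; argmax-all; f[xs]≤f[argmax])
open import Data.List.Membership.Propositional using () renaming (_∈_ to _∈ₗ_)
open import Data.List.Membership.Propositional.Properties
  using (∈-map⁺; ∈-cartesianProductWith⁺; ∈-filter⁺; ∈-allFin)
open import Data.Maybe using (Maybe; just; nothing; is-just; fromMaybe)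
open import Data.Maybe.Properties using (just-injective) renaming (≡-dec to ≡-decₘ)
open import Data.Nat using (ℕ; suc; _+_; _≤_; _<_; _≤?_; s≤s)
open import Data.Nat.ListAction using (sum)
open import Data.Nat.Properties using (≤-refl; ≤-trans; ≤-reflexive; n≤1+n; +-suc; <⇒≱; module ≤-Reasoning)
open import Data.Product using (∃; _,_; proj₁; proj₂)
open import Data.Sum using (inj₁; inj₂)
open import Data.Vec as Vec using (Vec; []; _∷_; here; there; lookup; replicate; tabulate; _[_]≔_)
open import Data.Vec.Properties
  using (lookup-map; lookup∘tabulate; lookup-replicate; lookup∘update; lookup∘update′; []=⇒lookup; lookup⇒[]=)
open import Function using (_∘_; _$_)
open import Function.Definitions using (Injective)
open import Relation.Binary.PropositionalEquality
  using (_≡_; _≢_; refl; sym; trans; cong; setoid; module ≡-Reasoning)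
open import Relation.Nullary using (¬_; Dec; yes; no; ¬?; contradiction)
open import Relation.Nullary.Decidable using (_×-dec_; _→-dec_)
open import Relation.Unary using (Decidable)

Enumerates : (A : Set) → List A → Set
Enumerates A = IsEnumeration (setoid A)

module _ {A : Set} where

  vectors : List A → (n : ℕ) → List (Vec A n)
  vectors xs 0 = [ [] ]
  vectors xs (suc n) = cartesianProductWith _∷_ xs (vectors xs n)

  vectors-enumerates : ∀ {xs} → Enumerates A xs → ∀ n → Enumerates (Vec A n) (vectors xs n)
  vectors-enumerates xs! 0 [] = Any.here refl
  vectors-enumerates xs! (suc n) (x ∷ v) =
    ∈-cartesianProductWith⁺ _∷_ (xs! x) (vectors-enumerates xs! n v)

  injection⇒≤length : ∀ {n} xs (f : Fin n → A) → Injective _≡_ _≡_ f → (∀ i → f i ∈ₗ xs) → n ≤ length xs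
  injection⇒≤length xs f f-injective f∈xs = injective⇒≤ {f = index ∘ f∈xs} index-injective
    where
    index-injective : Injective _≡_ _≡_ (index ∘ f∈xs)
    index-injective {i} {j} eq = f-injective (begin
      f i                             ≡⟨ lookup-index (f∈xs i) ⟩
      List.lookup xs (index (f∈xs i)) ≡⟨ cong (List.lookup xs) eq ⟩
      List.lookup xs (index (f∈xs j)) ≡⟨ lookup-index (f∈xs j) ⟨
      f j                             ∎)
      where open ≡-Reasoning

maybes : ∀ k → List (Maybe (Fin k))
maybes k = nothing ∷ List.map just (allFin k)

maybes-enumerates : ∀ k → Enumerates (Maybe (Fin k)) (maybes k)
maybes-enumerates k nothing = Any.here refl
maybes-enumerates k (just i) = Any.there (∈-map⁺ just (∈-allFin i))

maximiser : ∀ {A : Set} {P : A → Set} → Decidable P → ∀ {xs} → Enumerates A xs →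
  (w : A → ℕ) → ∃ P → ∃ λ x → P x × (∀ y → P y → w y ≤ w x)
maximiser P? {xs} xs! w (x₀ , Px₀) =
  best , argmax-all w Px₀ (all-filter P? xs) ,
  λ y Py → All.lookup (f[xs]≤f[argmax] x₀ (filter P? xs)) (∈-filter⁺ P? (xs! y) Py)
  where best = argmax w x₀ (filter P? xs)

lex-maximiser : ∀ {A : Set} {P : A → Set} → Decidable P → ∀ {xs} → Enumerates A xs →
  (u v : A → ℕ) → ∃ P → ∃ λ x → P x × (∀ y → P y → u y ≤ u x) × (∀ y → P y → u x ≤ u y → v y ≤ v x)
lex-maximiser P? xs! u v P-inhabited
  with x₁ , Px₁ , u-max ← maximiser P? xs! u P-inhabited
  with x₂ , (Px₂ , u₁≤u₂) , v-max ← maximiser (λ y → P? y ×-dec (u x₁ ≤? u y)) xs! v (x₁ , Px₁ , ≤-refl)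
  = x₂ , Px₂ , (λ y Py → ≤-trans (u-max y Py) u₁≤u₂) ,
    λ y Py u₂≤uy → v-max y (Py , ≤-trans u₁≤u₂ u₂≤uy)

module _ {n : ℕ} where

  Disjoint : Subset n → Subset n → Set
  Disjoint p q = ∀ {x} → x ∈ p → x ∉ q

  Disjoint-⋃ : ∀ {p ps} → All (Disjoint p) ps → Disjoint p (⋃ ps)
  Disjoint-⋃ [] x∈p = ∉⊥
  Disjoint-⋃ {ps = q ∷ qs} (p#q ∷ p#qs) x∈p x∈q∪qs with x∈p∪q⁻ q (⋃ qs) x∈q∪qs
  ... | inj₁ x∈q = p#q x∈p x∈q
  ... | inj₂ x∈qs = Disjoint-⋃ p#qs x∈p x∈qs

  x∈⋃⁻ : ∀ {x} (ps : List (Subset n)) → x ∈ ⋃ ps → Any (x ∈_) ps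
  x∈⋃⁻ [] x∈⊥ = contradiction x∈⊥ ∉⊥
  x∈⋃⁻ (p ∷ ps) x∈p∪ps with x∈p∪q⁻ p (⋃ ps) x∈p∪ps
  ... | inj₁ x∈p = Any.here x∈p
  ... | inj₂ x∈ps = Any.there (x∈⋃⁻ ps x∈ps)

Disjoint-tail : ∀ {n s t} {p q : Subset n} → Disjoint (s ∷ p) (t ∷ q) → Disjoint p q
Disjoint-tail sp#tq x∈p x∈q = sp#tq (there x∈p) (there x∈q)

∣p∪q∣≡∣p∣+∣q∣ : ∀ {n} (p q : Subset n) → Disjoint p q → ∣ p ∪ q ∣ ≡ ∣ p ∣ + ∣ q ∣
∣p∪q∣≡∣p∣+∣q∣ [] [] _ = refl
∣p∪q∣≡∣p∣+∣q∣ (inside ∷ p) (inside ∷ q) p#q = contradiction here (p#q here)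
∣p∪q∣≡∣p∣+∣q∣ (inside ∷ p) (outside ∷ q) p#q = cong suc (∣p∪q∣≡∣p∣+∣q∣ p q (Disjoint-tail p#q))
∣p∪q∣≡∣p∣+∣q∣ (outside ∷ p) (inside ∷ q) p#q =
  trans (cong suc (∣p∪q∣≡∣p∣+∣q∣ p q (Disjoint-tail p#q))) (sym (+-suc ∣ p ∣ ∣ q ∣))
∣p∪q∣≡∣p∣+∣q∣ (outside ∷ p) (outside ∷ q) p#q = ∣p∪q∣≡∣p∣+∣q∣ p q (Disjoint-tail p#q)

∣⋃ps∣≡sum∣ps∣ : ∀ {n} (ps : List (Subset n)) → AllPairs Disjoint ps → ∣ ⋃ ps ∣ ≡ sum (List.map ∣_∣ ps)
∣⋃ps∣≡sum∣ps∣ {n} [] [] = ∣⊥∣≡0 n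
∣⋃ps∣≡sum∣ps∣ (p ∷ ps) (p#ps ∷ ps!) =
  trans (∣p∪q∣≡∣p∣+∣q∣ p (⋃ ps) (Disjoint-⋃ p#ps)) (cong (∣ p ∣ +_) (∣⋃ps∣≡sum∣ps∣ ps ps!))

∣p∣≤1+∣p-x∣ : ∀ {n} (p : Subset n) x → ∣ p ∣ ≤ suc ∣ p - x ∣
∣p∣≤1+∣p-x∣ (inside ∷ p) zero = s≤s (≤-reflexive (cong ∣_∣ (sym (p─⊥≡p p))))
∣p∣≤1+∣p-x∣ (outside ∷ p) zero = ≤-trans (≤-reflexive (cong ∣_∣ (sym (p─⊥≡p p)))) (n≤1+n _)
∣p∣≤1+∣p-x∣ (inside ∷ p) (suc x) = s≤s (∣p∣≤1+∣p-x∣ p x)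
∣p∣≤1+∣p-x∣ (outside ∷ p) (suc x) = ∣p∣≤1+∣p-x∣ p x

x∉p-x : ∀ {n} (p : Subset n) x → x ∉ p - x
x∉p-x (_ ∷ p) zero ()
x∉p-x (_ ∷ p) (suc x) (there x∈p-x) = x∉p-x p x x∈p-x

p-x⊂q⇒∣p∣≤∣q∣ : ∀ {n} {p q : Subset n} {x} → p - x ⊂ q → ∣ p ∣ ≤ ∣ q ∣
p-x⊂q⇒∣p∣≤∣q∣ {p = p} {x = x} p-x⊂q = ≤-trans (∣p∣≤1+∣p-x∣ p x) (p⊂q⇒∣p∣<∣q∣ p-x⊂q)

module PartialColourings (G : Graph) (k : ℕ) where

  -- A partial k-edge-colouring (nothing = uncoloured), as a vector so that all of them can be listed.
  Colouring : Set
  Colouring = Vec (Maybe (Fin k)) (m G)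

  Proper : Colouring → Set
  Proper c = ∀ e f a → e ≢ f → Adjacent G e f → lookup c e ≡ just a → lookup c f ≢ just a

  coloured : Colouring → Subset (m G)
  coloured = Vec.map is-just

  MissingAt : Colouring → Fin (n G) → Fin k → Set
  MissingAt c v b = ∀ f → IncidentTo G v f → lookup c f ≢ just b

  _≟ₘ_ : (x y : Maybe (Fin k)) → Dec (x ≡ y)
  _≟ₘ_ = ≡-decₘ _≟_

  adjacent? : ∀ e f → Dec (Adjacent G e f)
  adjacent? e f = any? λ v → incident? G v e ×-dec incident? G v f

  proper? : Decidable Proper
  proper? c = all? λ e → all? λ f → all? λ a →
    ¬? (e ≟ f) →-dec adjacent? e f →-dec (lookup c e ≟ₘ just a) →-dec ¬? (lookup c f ≟ₘ just a)

  empty-proper : Proper (replicate (m G) nothing)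
  empty-proper e f a _ _ ce _ with () ← trans (sym (lookup-replicate e nothing)) ce

  ∈-coloured⁺ : ∀ {c e a} → lookup c e ≡ just a → e ∈ coloured c
  ∈-coloured⁺ {c} {e} ce = lookup⇒[]= e (coloured c) (trans (lookup-map e is-just c) (cong is-just ce))

  ∈-coloured⁻ : ∀ {c e} → e ∈ coloured c → ∃ λ a → lookup c e ≡ just a
  ∈-coloured⁻ {c} {e} e∈c with lookup c e in ce
  ... | just a = a , refl
  ... | nothing with () ← trans (sym (trans (lookup-map e is-just c) (cong is-just ce))) ([]=⇒lookup e∈c)

  ∉-coloured : ∀ {c e} → lookup c e ≡ nothing → e ∉ coloured c
  ∉-coloured ce e∈c with a , ce′ ← ∈-coloured⁻ e∈c with () ← trans (sym ce) ce′

  proper⇒colourable : Fin k → ∀ {c} → Proper c → KEdgeColorable G k (coloured c)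
  proper⇒colourable b₀ {c} proper = colour , distinct
    where
    colour : Fin (m G) → Fin k
    colour e = fromMaybe b₀ (lookup c e)
    distinct : ∀ e f → e ∈ coloured c → f ∈ coloured c → ¬ e ≡ f → Adjacent G e f → ¬ colour e ≡ colour f
    distinct e f e∈c f∈c e≢f e~f same
      with a , ce ← ∈-coloured⁻ e∈c | a′ , cf ← ∈-coloured⁻ f∈c =
      proper e f a e≢f e~f ce (trans cf (cong just (trans (sym (cong (fromMaybe b₀) cf))
        (trans (sym same) (cong (fromMaybe b₀) ce)))))

  module _ (Ms : Fin k → Subset (m G)) where

    classOf : Fin (m G) → Maybe (Fin k)
    classOf e with any? (λ i → e ∈? Ms i)
    ... | yes (i , _) = just i
    ... | no _ = nothing

    classOf-sound : ∀ e {a} → classOf e ≡ just a → e ∈ Ms a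
    classOf-sound e eq with any? (λ i → e ∈? Ms i)
    classOf-sound e refl | yes (i , e∈Msᵢ) = e∈Msᵢ

    classOf-complete : ∀ {e i} → e ∈ Ms i → ∃ λ a → classOf e ≡ just a
    classOf-complete {e} {i} e∈Msᵢ with any? (λ i → e ∈? Ms i)
    ... | yes (j , _) = j , refl
    ... | no none = contradiction (i , e∈Msᵢ) none

    classes : Colouring
    classes = tabulate classOf

    classes-proper : DisjointMatchings G k Ms → Proper classes
    classes-proper (matching , _) e f a e≢f e~f ce cf = matching a e f (sound ce) (sound cf) e≢f e~f
      where
      sound : ∀ {g} → lookup classes g ≡ just a → g ∈ Ms a
      sound {g} cg = classOf-sound g (trans (sym (lookup∘tabulate classOf g)) cg)

    ⋃Ms⊆coloured-classes : ⋃ (List.map Ms (allFin k)) ⊆ coloured classes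
    ⋃Ms⊆coloured-classes {e} e∈⋃ with i , e∈Msᵢ ← satisfied (Any.map⁻ {f = Ms} {xs = allFin k} (x∈⋃⁻ _ e∈⋃))
      with a , ce ← classOf-complete e∈Msᵢ = ∈-coloured⁺ (trans (lookup∘tabulate classOf e) ce)

    totalSize≤∣coloured-classes∣ : DisjointMatchings G k Ms → totalSize G k Ms ≤ ∣ coloured classes ∣
    totalSize≤∣coloured-classes∣ (_ , disjoint) = begin
      totalSize G k Ms                            ≡⟨ cong sum (map-∘ (allFin k)) ⟩
      sum (List.map ∣_∣ (List.map Ms (allFin k))) ≡⟨ ∣⋃ps∣≡sum∣ps∣ _ pairwise-disjoint ⟨
      ∣ ⋃ (List.map Ms (allFin k)) ∣              ≤⟨ p⊆q⇒∣p∣≤∣q∣ ⋃Ms⊆coloured-classes ⟩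
      ∣ coloured classes ∣                        ∎
      where
      open ≤-Reasoning
      pairwise-disjoint : AllPairs Disjoint (List.map Ms (allFin k))
      pairwise-disjoint = AllPairs.map⁺ (AllPairs.tabulate⁺ λ i≢j x∈Msᵢ → disjoint _ _ _ i≢j x∈Msᵢ)

  incidence-injection⇒≤degree : ∀ {v n} (edge : Fin n → Fin (m G)) → Injective _≡_ _≡_ edge →
    (∀ i → IncidentTo G v (edge i)) → n ≤ degree G v
  incidence-injection⇒≤degree {v} edge edge-injective v~edge =
    injection⇒≤length _ edge edge-injective λ i → ∈-filter⁺ (incident? G v) (∈-allFin (edge i)) (v~edge i)

  all-colours-present⇒k<degree : ∀ {c v e} → IncidentTo G v e → lookup c e ≡ nothing →
    (∀ b → ∃ λ f → IncidentTo G v f × lookup c f ≡ just b) → k < degree G v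
  -- e and one edge of each colour are k + 1 distinct edges at v.
  all-colours-present⇒k<degree {c} {v} {e} v~e ce present =
    incidence-injection⇒≤degree edge edge-injective v~edge
    where
    edge : Fin (suc k) → Fin (m G)
    edge zero = e
    edge (suc b) = proj₁ (present b)
    v~edge : ∀ i → IncidentTo G v (edge i)
    v~edge zero = v~e
    v~edge (suc b) = proj₁ (proj₂ (present b))
    label : Fin (suc k) → Maybe (Fin k)
    label zero = nothing
    label (suc b) = just b
    colour-edge : ∀ i → lookup c (edge i) ≡ label i
    colour-edge zero = ce
    colour-edge (suc b) = proj₂ (proj₂ (present b))
    label-injective : Injective _≡_ _≡_ label
    label-injective {zero} {zero} _ = refl
    label-injective {zero} {suc _} ()
    label-injective {suc _} {zero} ()
    label-injective {suc b} {suc b′} eq = cong suc (just-injective eq)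
    edge-injective : Injective _≡_ _≡_ edge
    edge-injective {i} {j} eq =
      label-injective (trans (sym (colour-edge i)) (trans (cong (lookup c) eq) (colour-edge j)))

  present? : ∀ c v b → Dec (∃ λ f → IncidentTo G v f × lookup c f ≡ just b)
  present? c v b = any? λ f → incident? G v f ×-dec (lookup c f ≟ₘ just b)

  missing-colour : ∀ {c v e} → degree G v ≤ k → IncidentTo G v e → lookup c e ≡ nothing → ∃ (MissingAt c v)
  missing-colour {c} {v} {e} deg≤k v~e ce with all? (present? c v)
  ... | yes present = contradiction deg≤k (<⇒≱ (all-colours-present⇒k<degree {c} v~e ce present))
  ... | no ¬present with b , absent ← ¬∀⟶∃¬ k _ (present? c v) ¬present =
    b , λ f v~f cf → absent (f , v~f , cf)

  lookup-uncolour : ∀ (c : Colouring) f {g a} → lookup (c [ f ]≔ nothing) g ≡ just a → lookup c g ≡ just a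
  lookup-uncolour c f {g} cg with g ≟ f
  ... | yes refl with () ← trans (sym (lookup∘update f c nothing)) cg
  ... | no g≢f = trans (sym (lookup∘update′ g≢f c nothing)) cg

  uncolour-proper : ∀ {c f} → Proper c → Proper (c [ f ]≔ nothing)
  uncolour-proper {c} {f} proper e e′ a e≢e′ e~e′ ce ce′ =
    proper e e′ a e≢e′ e~e′ (lookup-uncolour c f ce) (lookup-uncolour c f ce′)

  uncolour-missing : ∀ {c v b f} → MissingAt c v b → MissingAt (c [ f ]≔ nothing) v b
  uncolour-missing {c} {f = f} missing g v~g cg = missing g v~g (lookup-uncolour c f cg)

  uncolour-frees : ∀ {c v b f} → Proper c → IncidentTo G v f → lookup c f ≡ just b →
    MissingAt (c [ f ]≔ nothing) v b
  uncolour-frees {c} {v} {b} {f} proper v~f cf g v~g cg with g ≟ f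
  ... | yes refl with () ← trans (sym (lookup∘update f c nothing)) cg
  ... | no g≢f = proper g f b g≢f (v , v~g , v~f) (lookup-uncolour c f cg) cf

  missing-at-ends : ∀ {c e b w} → MissingAt c (proj₁ (ends G e)) b → MissingAt c (proj₂ (ends G e)) b →
    IncidentTo G w e → MissingAt c w b
  missing-at-ends missing₁ _ (inj₁ refl) = missing₁
  missing-at-ends _ missing₂ (inj₂ refl) = missing₂

  assign-proper : ∀ {c e b} → Proper c →
    MissingAt c (proj₁ (ends G e)) b → MissingAt c (proj₂ (ends G e)) b → Proper (c [ e ]≔ just b)
  assign-proper {c} {e} {b} proper missing₁ missing₂ x y a x≢y (w , w~x , w~y) cx cy with x ≟ e | y ≟ e
  ... | yes refl | yes refl = x≢y refl
  ... | yes refl | no y≢e = missing-at-ends {c} missing₁ missing₂ w~x y w~y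
    (trans (sym (lookup∘update′ y≢e c (just b))) (trans cy (trans (sym cx) (lookup∘update e c (just b)))))
  ... | no x≢e | yes refl = missing-at-ends {c} missing₁ missing₂ w~y x w~x
    (trans (sym (lookup∘update′ x≢e c (just b))) (trans cx (trans (sym cy) (lookup∘update e c (just b)))))
  ... | no x≢e | no y≢e = proper x y a x≢y (w , w~x , w~y)
    (trans (sym (lookup∘update′ x≢e c (just b))) cx) (trans (sym (lookup∘update′ y≢e c (just b))) cy)

  ∈-coloured-assign : ∀ {c : Colouring} {e a} → e ∈ coloured (c [ e ]≔ just a)
  ∈-coloured-assign {c} {e} {a} = ∈-coloured⁺ (lookup∘update e c (just a))

  ∈-coloured-update : ∀ {c : Colouring} {e g x} → g ≢ e → g ∈ coloured c → g ∈ coloured (c [ e ]≔ x)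
  ∈-coloured-update {c} {e} {g} {x} g≢e g∈c with a , cg ← ∈-coloured⁻ g∈c =
    ∈-coloured⁺ (trans (lookup∘update′ g≢e c x) cg)

  module _ (F : Subset (m G)) where

    record Optimal (c : Colouring) : Set where
      field
        proper : Proper c
        max-coloured : ∀ c′ → Proper c′ → ∣ coloured c′ ∣ ≤ ∣ coloured c ∣
        max-coloured-in-F : ∀ c′ → Proper c′ → ∣ coloured c ∣ ≤ ∣ coloured c′ ∣ →
          ∣ coloured c′ ∩ F ∣ ≤ ∣ coloured c ∩ F ∣

    optimal-exists : ∃ Optimal
    optimal-exists
      with c , proper , max₁ , max₂ ← lex-maximiser proper? (vectors-enumerates (maybes-enumerates k) (m G))
             (∣_∣ ∘ coloured) (λ c → ∣ coloured c ∩ F ∣) (replicate (m G) nothing , empty-proper)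
      = c , record { proper = proper ; max-coloured = max₁ ; max-coloured-in-F = max₂ }

    module _ {c : Colouring} (optimal : Optimal c) where
      open Optimal optimal

      uncoloured-not-extendable : ∀ {e b} → lookup c e ≡ nothing →
        MissingAt c (proj₁ (ends G e)) b → MissingAt c (proj₂ (ends G e)) b → ⊥
      uncoloured-not-extendable {e} {b} ce missing₁ missing₂ =
        <⇒≱ (p⊂q⇒∣p∣<∣q∣ c⊂c₁) (max-coloured c₁ (assign-proper {c} proper missing₁ missing₂))
        where
        c₁ = c [ e ]≔ just b
        c⊂c₁ : coloured c ⊂ coloured c₁
        c⊂c₁ = (λ g∈c → ∈-coloured-update (λ { refl → ∉-coloured ce g∈c }) g∈c) ,
               e , ∈-coloured-assign , ∉-coloured ce

      uncoloured-F-edge-not-exchangeable : ∀ {e f b} → IsMatching G F → e ∈ F → lookup c e ≡ nothing →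
        MissingAt c (proj₂ (ends G e)) b → IncidentTo G (proj₁ (ends G e)) f → lookup c f ≡ just b → ⊥
      -- Moving colour b from f to e: f ∉ F as it meets e, so c₂ colours as many edges and more of F.
      uncoloured-F-edge-not-exchangeable {e} {f} {b} matching e∈F ce missing₂ u~f cf =
        <⇒≱ more-in-F (max-coloured-in-F c₂ proper₂ as-many)
        where
        c₂ = (c [ f ]≔ nothing) [ e ]≔ just b
        proper₂ : Proper c₂
        proper₂ = assign-proper {c [ f ]≔ nothing} (uncolour-proper {c} {f} proper)
          (uncolour-frees {c} proper u~f cf) (uncolour-missing {c} {f = f} missing₂)
        f∉F : f ∉ F
        f∉F f∈F = matching e f e∈F f∈F (λ { refl → contradiction (trans (sym ce) cf) λ () })
          (proj₁ (ends G e) , inj₁ refl , u~f)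
        kept : ∀ {g} → g ∈ coloured c → g ≢ f → g ∈ coloured c₂
        kept g∈c g≢f = ∈-coloured-update (λ { refl → ∉-coloured ce g∈c }) (∈-coloured-update g≢f g∈c)
        as-many : ∣ coloured c ∣ ≤ ∣ coloured c₂ ∣
        as-many = p-x⊂q⇒∣p∣≤∣q∣ {x = f}
          ( (λ g∈c-f → kept (p─q⊆p _ _ g∈c-f) λ { refl → x∉p-x _ f g∈c-f })
          , e , ∈-coloured-assign , λ e∈c-f → ∉-coloured ce (p─q⊆p _ _ e∈c-f))
        more-in-F : ∣ coloured c ∩ F ∣ < ∣ coloured c₂ ∩ F ∣
        more-in-F = p⊂q⇒∣p∣<∣q∣
          ( (λ g∈c∩F → let g∈c , g∈F = x∈p∩q⁻ _ _ g∈c∩F in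
               x∈p∩q⁺ (kept g∈c (λ { refl → f∉F g∈F }) , g∈F))
          , e , x∈p∩q⁺ (∈-coloured-assign , e∈F) , λ e∈c∩F → ∉-coloured ce (proj₁ (x∈p∩q⁻ _ _ e∈c∩F)))

      optimal⇒maximum : ∀ Ms → DisjointMatchings G k Ms → totalSize G k Ms ≤ ∣ coloured c ∣
      optimal⇒maximum Ms disjoint =
        ≤-trans (totalSize≤∣coloured-classes∣ Ms disjoint)
          (max-coloured (classes Ms) (classes-proper Ms disjoint))

      optimal⇒F⊆coloured : (∀ v → degree G v ≤ k) → IsMatching G F → F ⊆ coloured c
      optimal⇒F⊆coloured deg≤k matching {e} e∈F with lookup c e in ce
      ... | just a = ∈-coloured⁺ ce
      ... | nothing
        with b , missing₂ ← missing-colour {c} (deg≤k _) (inj₂ refl) ce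
        with present? c (proj₁ (ends G e)) b
      ... | no absent = ⊥-elim $ uncoloured-not-extendable ce (λ f u~f cf → absent (f , u~f , cf)) missing₂
      ... | yes (f , u~f , cf) = ⊥-elim $ uncoloured-F-edge-not-exchangeable matching e∈F ce missing₂ u~f cf

    matching⊆maximum-colourable : Fin k → (∀ v → degree G v ≤ k) → IsMatching G F →
      Σ (Subset (m G)) λ H → MaxKEdgeColorable G k H × F ⊆ H
    matching⊆maximum-colourable b₀ deg≤k matching with c , optimal ← optimal-exists =
      coloured c , (proper⇒colourable b₀ (Optimal.proper optimal) , optimal⇒maximum optimal) ,
      optimal⇒F⊆coloured optimal deg≤k matching

theorem2 : (G : Graph) → Cubic G → (F : Subset (m G)) → IsPerfectMatching G F →
    Σ (Subset (m G)) λ H → MaxKEdgeColorable G 3 H × F ⊆ H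
theorem2 G cubic F (matching , _) =
  PartialColourings.matching⊆maximum-colourable G 3 F zero (≤-reflexive ∘ cubic) matching
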